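{- For every even $n\ge 2$, Snort played on the (initially uncoloured, untinted) graph $G_n$ is a first player win, where $G_n$ is obtained from $T_{n,3}$ by adding two new vertices $R_2, R_3$ and the edges $(n,1)\sim R_2$, $(n,2)\sim R_2$, $(n,2)\sim R_3$, $(n,3)\sim R_3$, $R_2\sim R_3$.
   Context: Snort is a two-player game (players Left and Right) played on a finite simple graph. The players alternately colour a previously uncoloured vertex, Left in blue and Right in red, subject to the rule that no two adjacent vertices may receive opposite colours. Normal play: a player who cannot move on their turn loses. A game is a "first player win" if the player who moves first has a winning strategy, regardless of whether that player is Left or Right. $T_{n,3}$ is the graph with vertex set $\{(i,j): 1\le i\le n,\ 1\le j\le 3\}$ and edges $(i,j)\sim(i+1,j)$ for $1\le i\le n-1$, $1\le j\le 3$; $(i,j)\sim(i,j+1)$ for $1\le i\le n$, $1\le j\le 2$; and $(i,j)\sim(i+1,j+1)$ for $1\le i\le n-1$, $1\le j\le 2$. -}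

module Defs where

open import Data.Nat using (ℕ; suc; _+_)
open import Data.Fin using (Fin; toℕ)
open import Data.Product using (_×_; _,_; Σ)
open import Data.Sum using (_⊎_; inj₁; inj₂)
open import Data.Empty using (⊥)
open import Level using (0ℓ)
open import Relation.Nullary using (¬_; yes; no)
open import Relation.Binary using (DecidableEquality)
open import Relation.Binary.PropositionalEquality using (_≡_; _≢_)
import Data.Fin.Properties as FinP
import Data.Product.Properties as ProdP
import Data.Sum.Properties as SumP

record Graph : Set₁ where
  field
    V    : Set
    _≟V_ : DecidableEquality V
    Adj  : V → V → Set

data Player : Set where
  Left Right : Player

opp : Player → Player
opp Left  = Right
opp Right = Left

-- state of a vertex: uncoloured, or coloured by a player
-- (blue = coloured by Left, red = coloured by Right)
data Cell : Set where
  uncol : Cell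
  col   : Player → Cell

module Snort (G : Graph) where
  open Graph G

  Position : Set
  Position = V → Cell

  start : Position
  start _ = uncol

  Legal : Player → Position → V → Set
  Legal p c v = (c v ≡ uncol) × (∀ w → Adj v w → c w ≢ col (opp p))

  play : Position → V → Player → Position
  play c v p w with w ≟V v
  ... | yes _ = col p
  ... | no  _ = c w

  -- Normal play.
  mutual
    data Wins (p : Player) (c : Position) : Set where
      win : (v : V) → Legal p c v → Loses (opp p) (play c v p) → Wins p c

    data Loses (p : Player) (c : Position) : Set where
      lose : ((v : V) → Legal p c v → Wins (opp p) (play c v p)) → Loses p c

  FirstPlayerWin : Set
  FirstPlayerWin = Wins Left start × Wins Right start

-- The graph G_n.  Rows i ∈ Fin n (row k+1 of the paper is k here),
-- columns j ∈ Fin 3 (column k+1 of the paper is k here);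
-- extra vertices R₂ = inj₂ 0, R₃ = inj₂ 1.

GVert : ℕ → Set
GVert n = (Fin n × Fin 3) ⊎ Fin 2

_≟G_ : ∀ {n} → DecidableEquality (GVert n)
_≟G_ = SumP.≡-dec (ProdP.≡-dec FinP._≟_ FinP._≟_) FinP._≟_

data TEdge {n : ℕ} : Fin n × Fin 3 → Fin n × Fin 3 → Set where
  down  : ∀ {i i' j j'} → toℕ i' ≡ suc (toℕ i) → toℕ j' ≡ toℕ j → TEdge (i , j) (i' , j')
  right : ∀ {i i' j j'} → toℕ i' ≡ toℕ i → toℕ j' ≡ suc (toℕ j) → TEdge (i , j) (i' , j')
  diag  : ∀ {i i' j j'} → toℕ i' ≡ suc (toℕ i) → toℕ j' ≡ suc (toℕ j) → TEdge (i , j) (i' , j')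

data GEdge (n : ℕ) : GVert n → GVert n → Set where
  tri   : ∀ {x y} → TEdge x y → GEdge n (inj₁ x) (inj₁ y)
  toR₂  : ∀ {i j} → suc (toℕ i) ≡ n → (toℕ j ≡ 0 ⊎ toℕ j ≡ 1)
        → GEdge n (inj₁ (i , j)) (inj₂ Fin.zero)
  toR₃  : ∀ {i j} → suc (toℕ i) ≡ n → (toℕ j ≡ 1 ⊎ toℕ j ≡ 2)
        → GEdge n (inj₁ (i , j)) (inj₂ (Fin.suc Fin.zero))
  R₂R₃  : GEdge n (inj₂ Fin.zero) (inj₂ (Fin.suc Fin.zero))

GAdj : (n : ℕ) → GVert n → GVert n → Set
GAdj n x y = GEdge n x y ⊎ GEdge n y x

G : ℕ → Graph
G n = record { V = GVert n ; _≟V_ = _≟G_ ; Adj = GAdj n }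

-- The first player colours the centre (m , 1) of the middle row of the
-- board, whose rows are 0 … 2m.  Translation by m + 1 rows pairs row a with
-- row a + m + 1 for a < m; the one vertex left without a partner,
-- (m - 1 , 0), and the rest of row m are adjacent to the centre, so the
-- opponent can only ever colour paired vertices.  The first player answers
-- each move v with its partner v′.  The reply is legal: v′ is not adjacent
-- to v, and an opponent's vertex w next to v′ would make the first player's
-- vertex w′ a neighbour of v, because translation preserves adjacency.
module Submission where

open import Data.Empty using (⊥-elim)
open import Data.Fin using (Fin; toℕ; fromℕ<)
open import Data.Fin.Properties using (toℕ<n; toℕ-injective; toℕ-fromℕ<)
open import Data.List using (List; []; _∷_; map; _++_; cartesianProduct; allFin)
open import Data.List.Membership.Propositional using (_∈_)
open import Data.List.Membership.Propositional.Properties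
  using (∈-++⁺ˡ; ∈-++⁺ʳ; ∈-map⁺; ∈-cartesianProduct⁺; ∈-allFin)
open import Data.List.Relation.Unary.Any using (here; there)
open import Data.Nat using (ℕ; zero; suc; _+_; _*_; _∸_; _≤_; _<_; z≤n; s≤s)
open import Data.Nat.Divisibility using (_∣_; divides)
open import Data.Nat.Induction using (<-wellFounded)
open import Data.Nat.ListAction using (sum)
open import Data.Nat.Properties
open import Data.Product using (_×_; _,_; proj₁; proj₂)
open import Data.Product.Properties using (,-injectiveˡ; ,-injectiveʳ)
open import Data.Sum using (_⊎_; inj₁; inj₂; swap)
import Data.Sum as Sum
open import Function using (_∘_)
open import Induction.WellFounded using (Acc; acc)
open import Relation.Binary.PropositionalEquality
  using (_≡_; _≢_; refl; sym; trans; cong; cong₂; subst; subst₂; module ≡-Reasoning)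
open import Relation.Nullary using (¬_; yes; no)
open import Relation.Nullary.Decidable using (toSum)

open import Defs

opp-involutive : ∀ p → opp (opp p) ≡ p
opp-involutive Left  = refl
opp-involutive Right = refl

col≢col-opp : ∀ p → col p ≢ col (opp p)
col≢col-opp Left  ()
col≢col-opp Right ()

uncol≢col : ∀ {p} → uncol ≢ col p
uncol≢col ()

oppCell : Cell → Cell
oppCell uncol   = uncol
oppCell (col p) = col (opp p)

module PairingStrategy (G : Graph) where
  open Graph G
  open Snort G

  play-≡ : ∀ c v p → play c v p v ≡ col p
  play-≡ c v p with v ≟V v
  ... | yes _  = refl
  ... | no v≢v = ⊥-elim (v≢v refl)

  play-≢ : ∀ {c v p w} → w ≢ v → play c v p w ≡ c w
  play-≢ {v = v} {w = w} w≢v with w ≟V v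
  ... | yes w≡v = ⊥-elim (w≢v w≡v)
  ... | no _    = refl

  blank : Cell → ℕ
  blank uncol   = 1
  blank (col _) = 0

  #blank : Position → List V → ℕ
  #blank c xs = sum (map (blank ∘ c) xs)

  blank-play-≤ : ∀ c v p w → blank (play c v p w) ≤ blank (c w)
  blank-play-≤ c v p w with w ≟V v
  ... | yes _ = z≤n
  ... | no _  = ≤-refl

  #blank-play-≤ : ∀ c v p xs → #blank (play c v p) xs ≤ #blank c xs
  #blank-play-≤ c v p []       = z≤n
  #blank-play-≤ c v p (x ∷ xs) = +-mono-≤ (blank-play-≤ c v p x) (#blank-play-≤ c v p xs)

  #blank-play-< : ∀ {c v xs} p → c v ≡ uncol → v ∈ xs → #blank (play c v p) xs < #blank c xs
  #blank-play-< {c} {v} {_ ∷ xs} p cv≡uncol (here refl) =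
    +-mono-<-≤ played (#blank-play-≤ c v p xs)
    where
      played : blank (play c v p v) < blank (c v)
      played rewrite play-≡ c v p | cv≡uncol = s≤s z≤n
  #blank-play-< {c} {v} {x ∷ _} p cv≡uncol (there v∈xs) =
    +-mono-≤-< (blank-play-≤ c v p x) (#blank-play-< p cv≡uncol v∈xs)

  record Pairing : Set₁ where
    field
      centre             : V
      Paired             : V → Set
      partner            : V → V
      centre-unpaired    : ¬ Paired centre
      paired-if-apart    : ∀ {v} → v ≢ centre → ¬ Adj v centre → Paired v
      partner-paired     : ∀ {u} → Paired u → Paired (partner u)
      partner-involutive : ∀ {u} → Paired u → partner (partner u) ≡ u
      partner-adj        : ∀ {u w} → Paired u → Paired w → Adj u w → Adj (partner u) (partner w)
      partner-≢          : ∀ {u} → Paired u → partner u ≢ u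
      partner-nonadj     : ∀ {u} → Paired u → ¬ Adj (partner u) u

  module Strategy (vs : List V) (∈-vs : ∀ v → v ∈ vs) (P : Pairing) (p : Player) where
    open Pairing P

    -- Case splits on vertex equality go through toSum: a with on u ≟V v
    -- itself would also abstract that test inside play, and the lemmas
    -- about play below would then no longer match the goal.

    q : Player
    q = opp p

    paired-≢-centre : ∀ {u} → Paired u → u ≢ centre
    paired-≢-centre Pu refl = centre-unpaired Pu

    partner-injective : ∀ {u w} → Paired u → Paired w → partner u ≡ partner w → u ≡ w
    partner-injective Pu Pw e =
      trans (sym (partner-involutive Pu)) (trans (cong partner e) (partner-involutive Pw))

    record Mirrored (c : Position) : Set where
      field
        centre-taken : c centre ≡ col p
        partner-opp  : ∀ {u} → Paired u → c (partner u) ≡ oppCell (c u)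
        q-paired     : ∀ {w} → c w ≡ col q → Paired w
    open Mirrored

    legal-paired : ∀ {c v} → Mirrored c → Legal q c v → Paired v
    legal-paired {c} {v} M (cv≡uncol , safe) = paired-if-apart v≢centre v≁centre
      where
        v≢centre : v ≢ centre
        v≢centre refl = uncol≢col (trans (sym cv≡uncol) (centre-taken M))
        v≁centre : ¬ Adj v centre
        v≁centre adj = safe centre adj
          (trans (centre-taken M) (cong col (sym (opp-involutive p))))

    module Reply {c v} (M : Mirrored c) (legal : Legal q c v) where
      Pv : Paired v
      Pv = legal-paired M legal

      c′ c″ : Position
      c′ = play c v q
      c″ = play c′ (partner v) p

      partner-legal : Legal p c′ (partner v)
      partner-legal = partner-blank , safe
        where
          partner-blank : c′ (partner v) ≡ uncol
          partner-blank = trans (play-≢ (partner-≢ Pv))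
            (trans (partner-opp M Pv) (cong oppCell (proj₁ legal)))
          safe : ∀ w → Adj (partner v) w → c′ w ≢ col q
          safe w adj c′w≡q with toSum (w ≟V v)
          ... | inj₁ refl = partner-nonadj Pv adj
          ... | inj₂ w≢v  = proj₂ legal (partner w) v~partner-w
                             (trans (partner-opp M Pw) (cong oppCell cw≡q))
            where
              cw≡q : c w ≡ col q
              cw≡q = trans (sym (play-≢ w≢v)) c′w≡q
              Pw : Paired w
              Pw = q-paired M cw≡q
              v~partner-w : Adj v (partner w)
              v~partner-w = subst (λ u → Adj u (partner w)) (partner-involutive Pv)
                (partner-adj (partner-paired Pv) Pw adj)

      c″-v : c″ v ≡ col q
      c″-v = trans (play-≢ (partner-≢ Pv ∘ sym)) (play-≡ c v q)

      c″-partner : c″ (partner v) ≡ col p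
      c″-partner = play-≡ c′ (partner v) p

      c″-elsewhere : ∀ {w} → w ≢ v → w ≢ partner v → c″ w ≡ c w
      c″-elsewhere w≢v w≢pv = trans (play-≢ w≢pv) (play-≢ w≢v)

      mirrored : Mirrored c″
      centre-taken mirrored = trans
        (c″-elsewhere (paired-≢-centre Pv ∘ sym) (paired-≢-centre (partner-paired Pv) ∘ sym))
        (centre-taken M)
      partner-opp mirrored {u} Pu with toSum (u ≟V v) | toSum (u ≟V partner v)
      ... | inj₁ refl | _ =
        trans c″-partner (sym (trans (cong oppCell c″-v) (cong col (opp-involutive p))))
      ... | inj₂ _ | inj₁ refl =
        trans (cong c″ (partner-involutive Pv)) (trans c″-v (sym (cong oppCell c″-partner)))
      ... | inj₂ u≢v | inj₂ u≢pv = begin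
        c″ (partner u)  ≡⟨ c″-elsewhere pu≢v pu≢pv ⟩
        c (partner u)   ≡⟨ partner-opp M Pu ⟩
        oppCell (c u)   ≡⟨ cong oppCell (sym (c″-elsewhere u≢v u≢pv)) ⟩
        oppCell (c″ u)  ∎
        where
          open ≡-Reasoning
          pu≢v : partner u ≢ v
          pu≢v e = u≢pv (trans (sym (partner-involutive Pu)) (cong partner e))
          pu≢pv : partner u ≢ partner v
          pu≢pv e = u≢v (partner-injective Pu Pv e)
      q-paired mirrored {w} c″w≡q with toSum (w ≟V v) | toSum (w ≟V partner v)
      ... | inj₁ refl | _         = Pv
      ... | inj₂ _    | inj₁ refl = partner-paired Pv
      ... | inj₂ w≢v  | inj₂ w≢pv = q-paired M (trans (sym (c″-elsewhere w≢v w≢pv)) c″w≡q)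

      fewer-blanks : #blank c″ vs < #blank c vs
      fewer-blanks = ≤-<-trans (#blank-play-≤ c′ (partner v) p vs)
                               (#blank-play-< q (proj₁ legal) (∈-vs v))

    mirrored-loses : ∀ {c} → Acc _<_ (#blank c vs) → Mirrored c → Loses q c
    mirrored-loses (acc smaller) M = lose λ v legal →
      let open Reply M legal in
      subst (λ r → Wins r c′) (sym (opp-involutive p))
        (win (partner v) partner-legal (mirrored-loses (smaller fewer-blanks) mirrored))

    opening : Mirrored (play start centre p)
    centre-taken opening = play-≡ start centre p
    partner-opp opening Pu =
      trans (play-≢ (paired-≢-centre (partner-paired Pu)))
            (sym (cong oppCell (play-≢ (paired-≢-centre Pu))))
    q-paired opening {w} c₀w≡q with toSum (w ≟V centre)
    ... | inj₁ refl     = ⊥-elim (col≢col-opp p (trans (sym (play-≡ start centre p)) c₀w≡q))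
    ... | inj₂ w≢centre = ⊥-elim (uncol≢col (trans (sym (play-≢ w≢centre)) c₀w≡q))

    wins : Wins p start
    wins = win centre (refl , λ _ _ ()) (mirrored-loses (<-wellFounded _) opening)

  pairing⇒firstPlayerWin : (vs : List V) → (∀ v → v ∈ vs) → Pairing → FirstPlayerWin
  pairing⇒firstPlayerWin vs ∈-vs P =
    Strategy.wins vs ∈-vs P Left , Strategy.wins vs ∈-vs P Right

Point : Set
Point = ℕ × ℕ

data GridEdge : Point → Point → Set where
  down  : ∀ {a b a′ b′} → a′ ≡ suc a → b′ ≡ b     → GridEdge (a , b) (a′ , b′)
  right : ∀ {a b a′ b′} → a′ ≡ a     → b′ ≡ suc b → GridEdge (a , b) (a′ , b′)
  diag  : ∀ {a b a′ b′} → a′ ≡ suc a → b′ ≡ suc b → GridEdge (a , b) (a′ , b′)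

GridAdj : Point → Point → Set
GridAdj x y = GridEdge x y ⊎ GridEdge y x

GridEdge-rows : ∀ {a b a′ b′} → GridEdge (a , b) (a′ , b′) → a ≤ a′ × a′ ≤ suc a
GridEdge-rows {a} (down refl _)  = n≤1+n a , ≤-refl
GridEdge-rows {a} (right refl _) = ≤-refl , n≤1+n a
GridEdge-rows {a} (diag refl _)  = n≤1+n a , ≤-refl

GridEdge-sameRow : ∀ {a b b′} → GridEdge (a , b) (a , b′) → b′ ≡ suc b
GridEdge-sameRow (down e _)  = ⊥-elim (1+n≢n (sym e))
GridEdge-sameRow (right _ f) = f
GridEdge-sameRow (diag e _)  = ⊥-elim (1+n≢n (sym e))

GridAdj-row≤ : ∀ {a b a′ b′} → GridAdj (a , b) (a′ , b′) → a′ ≤ suc a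
GridAdj-row≤ (inj₁ e) = proj₂ (GridEdge-rows e)
GridAdj-row≤ (inj₂ e) = m≤n⇒m≤1+n (proj₁ (GridEdge-rows e))

RowsApart : ℕ → ℕ → Set
RowsApart a a′ = suc a < a′ ⊎ suc a′ < a

RowsApart⇒≢ : ∀ {a a′} → RowsApart a a′ → a ≢ a′
RowsApart⇒≢ (inj₁ lt) refl = <⇒≱ lt (n≤1+n _)
RowsApart⇒≢ (inj₂ lt) refl = <⇒≱ lt (n≤1+n _)

RowsApart⇒¬GridAdj : ∀ {a b a′ b′} → RowsApart a a′ → ¬ GridAdj (a , b) (a′ , b′)
RowsApart⇒¬GridAdj (inj₁ lt) adj = <⇒≱ lt (GridAdj-row≤ adj)
RowsApart⇒¬GridAdj (inj₂ lt) adj = <⇒≱ lt (GridAdj-row≤ (swap adj))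

+-suc-cong : ∀ t {x y} → x ≡ suc y → t + x ≡ suc (t + y)
+-suc-cong t {y = y} e = trans (cong (t +_) e) (+-suc t y)

+-suc-cancel : ∀ t {x y} → t + x ≡ suc (t + y) → x ≡ suc y
+-suc-cancel t {x} {y} e = +-cancelˡ-≡ t x (suc y) (trans e (sym (+-suc t y)))

GridEdge-shift : ∀ t {a b a′ b′} →
                 GridEdge (a , b) (a′ , b′) → GridEdge (t + a , b) (t + a′ , b′)
GridEdge-shift t (down e f)  = down (+-suc-cong t e) f
GridEdge-shift t (right e f) = right (cong (t +_) e) f
GridEdge-shift t (diag e f)  = diag (+-suc-cong t e) f

GridEdge-unshift : ∀ t {a b a′ b′} →
                   GridEdge (t + a , b) (t + a′ , b′) → GridEdge (a , b) (a′ , b′)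
GridEdge-unshift t                (down e f)  = down (+-suc-cancel t e) f
GridEdge-unshift t {a} {a′ = a′} (right e f) = right (+-cancelˡ-≡ t a′ a e) f
GridEdge-unshift t                (diag e f)  = diag (+-suc-cancel t e) f

GridAdj-shift : ∀ t {a b a′ b′} →
                GridAdj (a , b) (a′ , b′) → GridAdj (t + a , b) (t + a′ , b′)
GridAdj-shift t = Sum.map (GridEdge-shift t) (GridEdge-shift t)

GridAdj-unshift : ∀ t {a b a′ b′} →
                  GridAdj (t + a , b) (t + a′ , b′) → GridAdj (a , b) (a′ , b′)
GridAdj-unshift t = Sum.map (GridEdge-unshift t) (GridEdge-unshift t)

-- G n is the triangular grid on rows 0 … n and columns 0 … 2 with the
-- corner (n , 0) removed: R₂ and R₃ sit at (n , 1) and (n , 2).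
module Coordinates (n : ℕ) where

  pattern R₂ = inj₂ Fin.zero
  pattern R₃ = inj₂ (Fin.suc Fin.zero)

  pos : GVert n → Point
  pos (inj₁ (i , j)) = toℕ i , toℕ j
  pos R₂             = n , 1
  pos R₃             = n , 2

  data OnBoard : Point → Set where
    inner : ∀ {a b} → a < n → b < 3 → OnBoard (a , b)
    atR₂  : OnBoard (n , 1)
    atR₃  : OnBoard (n , 2)

  pos-onBoard : ∀ x → OnBoard (pos x)
  pos-onBoard (inj₁ (i , j)) = inner (toℕ<n i) (toℕ<n j)
  pos-onBoard R₂             = atR₂
  pos-onBoard R₃             = atR₃

  OnBoard-row≤ : ∀ {a b} → OnBoard (a , b) → a ≤ n
  OnBoard-row≤ (inner a<n _) = <⇒≤ a<n
  OnBoard-row≤ atR₂          = ≤-refl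
  OnBoard-row≤ atR₃          = ≤-refl

  OnBoard-column<3 : ∀ {a b} → OnBoard (a , b) → b < 3
  OnBoard-column<3 (inner _ b<3) = b<3
  OnBoard-column<3 atR₂          = s≤s (s≤s z≤n)
  OnBoard-column<3 atR₃          = ≤-refl

  lastRow-onBoard : ∀ {b} → 0 < b → b < 3 → OnBoard (n , b)
  lastRow-onBoard {1} _ _ = atR₂
  lastRow-onBoard {2} _ _ = atR₃
  lastRow-onBoard {suc (suc (suc _))} _ (s≤s (s≤s (s≤s ())))

  -- Points off the board are sent to an arbitrary vertex.
  vertexAt : Point → GVert n
  vertexAt (a , b) with a <? n | b <? 3
  ... | yes a<n | yes b<3 = inj₁ (fromℕ< a<n , fromℕ< b<3)
  vertexAt (_ , 1) | _ | _ = R₂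
  vertexAt (_ , _) | _ | _ = R₃

  pos-vertexAt : ∀ {x} → OnBoard x → pos (vertexAt x) ≡ x
  pos-vertexAt (inner {a} {b} a<n b<3) with a <? n | b <? 3
  ... | yes a<n′ | yes b<3′ = cong₂ _,_ (toℕ-fromℕ< a<n′) (toℕ-fromℕ< b<3′)
  ... | no a≮n   | _        = ⊥-elim (a≮n a<n)
  ... | yes _    | no b≮3   = ⊥-elim (b≮3 b<3)
  pos-vertexAt atR₂ with n <? n
  ... | yes n<n = ⊥-elim (<-irrefl refl n<n)
  ... | no _    = refl
  pos-vertexAt atR₃ with n <? n
  ... | yes n<n = ⊥-elim (<-irrefl refl n<n)
  ... | no _    = refl

  pos-injective : ∀ {x y} → pos x ≡ pos y → x ≡ y
  pos-injective {inj₁ _} {inj₁ _} e =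
    cong inj₁ (cong₂ _,_ (toℕ-injective (,-injectiveˡ e)) (toℕ-injective (,-injectiveʳ e)))
  pos-injective {inj₁ (i , _)} {R₂} e = ⊥-elim (<⇒≢ (toℕ<n i) (,-injectiveˡ e))
  pos-injective {inj₁ (i , _)} {R₃} e = ⊥-elim (<⇒≢ (toℕ<n i) (,-injectiveˡ e))
  pos-injective {R₂} {inj₁ (i , _)} e = ⊥-elim (<⇒≢ (toℕ<n i) (sym (,-injectiveˡ e)))
  pos-injective {R₃} {inj₁ (i , _)} e = ⊥-elim (<⇒≢ (toℕ<n i) (sym (,-injectiveˡ e)))
  pos-injective {R₂} {R₂} _ = refl
  pos-injective {R₃} {R₃} _ = refl
  pos-injective {R₂} {R₃} e with () ← ,-injectiveʳ e
  pos-injective {R₃} {R₂} e with () ← ,-injectiveʳ e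

  GEdge⇒GridEdge : ∀ {x y} → GEdge n x y → GridEdge (pos x) (pos y)
  GEdge⇒GridEdge (tri (down e f))    = down e f
  GEdge⇒GridEdge (tri (right e f))   = right e f
  GEdge⇒GridEdge (tri (diag e f))    = diag e f
  GEdge⇒GridEdge (toR₂ e (inj₁ j≡0)) = diag (sym e) (cong suc (sym j≡0))
  GEdge⇒GridEdge (toR₂ e (inj₂ j≡1)) = down (sym e) (sym j≡1)
  GEdge⇒GridEdge (toR₃ e (inj₁ j≡1)) = diag (sym e) (cong suc (sym j≡1))
  GEdge⇒GridEdge (toR₃ e (inj₂ j≡2)) = down (sym e) (sym j≡2)
  GEdge⇒GridEdge R₂R₃                = right refl refl

  GridEdge⇒GEdge : ∀ x y → GridEdge (pos x) (pos y) → GEdge n x y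
  GridEdge⇒GEdge (inj₁ _) (inj₁ _) (down e f)  = tri (down e f)
  GridEdge⇒GEdge (inj₁ _) (inj₁ _) (right e f) = tri (right e f)
  GridEdge⇒GEdge (inj₁ _) (inj₁ _) (diag e f)  = tri (diag e f)
  GridEdge⇒GEdge (inj₁ _) R₂ (down e f) = toR₂ (sym e) (inj₂ (sym f))
  GridEdge⇒GEdge (inj₁ _) R₂ (diag e f) = toR₂ (sym e) (inj₁ (suc-injective (sym f)))
  GridEdge⇒GEdge (inj₁ _) R₃ (down e f) = toR₃ (sym e) (inj₂ (sym f))
  GridEdge⇒GEdge (inj₁ _) R₃ (diag e f) = toR₃ (sym e) (inj₁ (suc-injective (sym f)))
  GridEdge⇒GEdge (inj₁ (i , _)) R₂ (right e _) = ⊥-elim (<⇒≢ (toℕ<n i) (sym e))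
  GridEdge⇒GEdge (inj₁ (i , _)) R₃ (right e _) = ⊥-elim (<⇒≢ (toℕ<n i) (sym e))
  GridEdge⇒GEdge R₂ (inj₁ (i , _)) e = ⊥-elim (<⇒≱ (toℕ<n i) (proj₁ (GridEdge-rows e)))
  GridEdge⇒GEdge R₃ (inj₁ (i , _)) e = ⊥-elim (<⇒≱ (toℕ<n i) (proj₁ (GridEdge-rows e)))
  GridEdge⇒GEdge R₂ R₃ _ = R₂R₃
  GridEdge⇒GEdge R₂ R₂ e with () ← GridEdge-sameRow e
  GridEdge⇒GEdge R₃ R₂ e with () ← GridEdge-sameRow e
  GridEdge⇒GEdge R₃ R₃ e with () ← GridEdge-sameRow e

  adj⇒GridAdj : ∀ {x y} → GAdj n x y → GridAdj (pos x) (pos y)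
  adj⇒GridAdj = Sum.map GEdge⇒GridEdge GEdge⇒GridEdge

  GridAdj⇒adj : ∀ x y → GridAdj (pos x) (pos y) → GAdj n x y
  GridAdj⇒adj x y = Sum.map (GridEdge⇒GEdge x y) (GridEdge⇒GEdge y x)

  vertices : List (GVert n)
  vertices = map inj₁ (cartesianProduct (allFin n) (allFin 3)) ++ map inj₂ (allFin 2)

  ∈-vertices : ∀ x → x ∈ vertices
  ∈-vertices (inj₁ (i , j)) =
    ∈-++⁺ˡ (∈-map⁺ inj₁ (∈-cartesianProduct⁺ (∈-allFin i) (∈-allFin j)))
  ∈-vertices (inj₂ k)       = ∈-++⁺ʳ _ (∈-map⁺ inj₂ (∈-allFin k))

module EvenBoard (h : ℕ) where

  m n : ℕ
  m = suc h
  n = m + m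

  open Coordinates n
  open PairingStrategy (G n)

  partnerRow : ℕ → ℕ
  partnerRow a with a <? m
  ... | yes _ = suc m + a
  ... | no _  = a ∸ suc m

  data PartnerRows : ℕ → ℕ → Set where
    lower : ∀ {a} → a < m → PartnerRows a (suc m + a)
    upper : ∀ {a} → a < m → PartnerRows (suc m + a) a

  PartnerRows-sym : ∀ {a a′} → PartnerRows a a′ → PartnerRows a′ a
  PartnerRows-sym (lower a<m) = upper a<m
  PartnerRows-sym (upper a<m) = lower a<m

  PartnerRows⇒partnerRow : ∀ {a a′} → PartnerRows a a′ → partnerRow a ≡ a′
  PartnerRows⇒partnerRow {a} (lower a<m) with a <? m
  ... | yes _   = refl
  ... | no a≮m = ⊥-elim (a≮m a<m)
  PartnerRows⇒partnerRow {a′ = a} (upper _) with suc m + a <? m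
  ... | yes lt = ⊥-elim (<⇒≱ lt (≤-trans (n≤1+n m) (m≤m+n (suc m) a)))
  ... | no _   = m+n∸m≡n (suc m) a

  upper-half : ∀ {r} → suc m + r ≤ n → r < m
  upper-half {r} le = +-cancelˡ-≤ m (suc r) m (subst (_≤ n) (sym (+-suc m r)) le)

  partnerRows : ∀ {a} → a ≢ m → a ≤ n → PartnerRows a (partnerRow a)
  partnerRows {a} a≢m a≤n with a <? m
  ... | yes a<m = lower a<m
  ... | no a≮m  = subst (λ r → PartnerRows r (a ∸ suc m)) a-split
                    (upper (upper-half (subst (_≤ n) (sym a-split) a≤n)))
    where
      a-split : suc m + (a ∸ suc m) ≡ a
      a-split = m+[n∸m]≡n (≤∧≢⇒< (≮⇒≥ a≮m) (a≢m ∘ sym))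

  partnerRow-involutive : ∀ {a} → a ≢ m → a ≤ n → partnerRow (partnerRow a) ≡ a
  partnerRow-involutive a≢m a≤n = PartnerRows⇒partnerRow (PartnerRows-sym (partnerRows a≢m a≤n))

  below-m-apart : ∀ {a} c → a < m → suc a < suc m + c
  below-m-apart c a<m = s≤s (≤-trans a<m (m≤m+n m c))

  PartnerRows⇒apart : ∀ {a a′} → PartnerRows a a′ → RowsApart a a′
  PartnerRows⇒apart (lower a<m) = inj₁ (below-m-apart _ a<m)
  PartnerRows⇒apart (upper a<m) = inj₂ (below-m-apart _ a<m)

  PartnerRows⇒≢m : ∀ {a a′} → PartnerRows a a′ → a′ ≢ m
  PartnerRows⇒≢m (lower _)   = >⇒≢ (s≤s (m≤m+n m _))
  PartnerRows⇒≢m (upper a<m) = <⇒≢ a<m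

  PartnerRows⇒≤n : ∀ {a a′} → PartnerRows a a′ → a′ ≤ n
  PartnerRows⇒≤n (lower {a} a<m) = subst (_≤ n) (+-suc m a) (+-monoʳ-≤ m a<m)
  PartnerRows⇒≤n (upper a<m)     = ≤-trans (<⇒≤ a<m) (m≤m+n m m)

  PartnerRows-last : ∀ {a a′} → PartnerRows a a′ → a′ ≡ n → a ≡ h
  PartnerRows-last (lower {a} _) e = suc-injective (+-cancelˡ-≡ m (suc a) m (trans (+-suc m a) e))
  PartnerRows-last (upper a<m)   e = ⊥-elim (<⇒≱ a<m (subst (m ≤_) (sym e) (m≤m+n m m)))

  PartnerRows-GridAdj : ∀ {a a′ b c c′ d} → PartnerRows a a′ → PartnerRows c c′ →
                        GridAdj (a , b) (c , d) → GridAdj (a′ , b) (c′ , d)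
  PartnerRows-GridAdj (lower _)   (lower _)   = GridAdj-shift (suc m)
  PartnerRows-GridAdj (upper _)   (upper _)   = GridAdj-unshift (suc m)
  PartnerRows-GridAdj (lower a<m) (upper _)   =
    ⊥-elim ∘ RowsApart⇒¬GridAdj (inj₁ (below-m-apart _ a<m))
  PartnerRows-GridAdj (upper _)   (lower c<m) =
    ⊥-elim ∘ RowsApart⇒¬GridAdj (inj₂ (below-m-apart _ c<m))

  PartnerRows-onBoard : ∀ {a a′ b} → PartnerRows a a′ → OnBoard (a , b) → (a , b) ≢ (h , 0) →
                        OnBoard (a′ , b)
  PartnerRows-onBoard pr ab ≢corner with m≤n⇒m<n∨m≡n (PartnerRows⇒≤n pr)
  ... | inj₁ a′<n = inner a′<n (OnBoard-column<3 ab)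
  ... | inj₂ refl = lastRow-onBoard
                      (n≢0⇒n>0 λ b≡0 → ≢corner (cong₂ _,_ (PartnerRows-last pr refl) b≡0))
                      (OnBoard-column<3 ab)

  partnerPoint : Point → Point
  partnerPoint (a , b) = partnerRow a , b

  PairedPoint : Point → Set
  PairedPoint (a , b) = a ≢ m × OnBoard (partnerRow a , b)

  Paired : GVert n → Set
  Paired x = PairedPoint (pos x)

  partnerVertex : GVert n → GVert n
  partnerVertex x = vertexAt (partnerPoint (pos x))

  pos-partnerVertex : ∀ x → Paired x → pos (partnerVertex x) ≡ partnerPoint (pos x)
  pos-partnerVertex _ (_ , partner-onBoard) = pos-vertexAt partner-onBoard

  row≤n : ∀ x → proj₁ (pos x) ≤ n
  row≤n x = OnBoard-row≤ (pos-onBoard x)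

  paired⇒partnerRows : ∀ x → Paired x → PartnerRows (proj₁ (pos x)) (partnerRow (proj₁ (pos x)))
  paired⇒partnerRows x (row≢m , _) = partnerRows row≢m (row≤n x)

  centre : GVert n
  centre = vertexAt (m , 1)

  pos-centre : pos centre ≡ (m , 1)
  pos-centre = pos-vertexAt (inner (m<m+n m (s≤s z≤n)) (s≤s (s≤s z≤n)))

  middleRow-near-centre : ∀ {a b} → a ≡ m → b < 3 → (a , b) ≡ (m , 1) ⊎ GridAdj (a , b) (m , 1)
  middleRow-near-centre {b = 0} refl _ = inj₂ (inj₁ (right refl refl))
  middleRow-near-centre {b = 1} refl _ = inj₁ refl
  middleRow-near-centre {b = 2} refl _ = inj₂ (inj₂ (right refl refl))
  middleRow-near-centre {b = suc (suc (suc _))} _ (s≤s (s≤s (s≤s ())))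

  centre-unpaired : ¬ Paired centre
  centre-unpaired (row≢m , _) = row≢m (cong proj₁ pos-centre)

  paired-if-apart : ∀ {x} → x ≢ centre → ¬ GAdj n x centre → Paired x
  paired-if-apart {x} x≢centre x≁centre =
    row≢m , PartnerRows-onBoard (partnerRows row≢m (row≤n x)) (pos-onBoard x) ≢corner
    where
      adj-centre : GridAdj (pos x) (m , 1) → GAdj n x centre
      adj-centre adj = GridAdj⇒adj x centre (subst (GridAdj (pos x)) (sym pos-centre) adj)
      row≢m : proj₁ (pos x) ≢ m
      row≢m e with middleRow-near-centre e (OnBoard-column<3 (pos-onBoard x))
      ... | inj₁ at-centre = x≢centre (pos-injective (trans at-centre (sym pos-centre)))
      ... | inj₂ adj       = x≁centre (adj-centre adj)
      ≢corner : pos x ≢ (h , 0)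
      ≢corner e = x≁centre
        (adj-centre (subst (λ p → GridAdj p (m , 1)) (sym e) (inj₁ (diag refl refl))))

  partnerPoint-involutive : ∀ x → Paired x → partnerPoint (partnerPoint (pos x)) ≡ pos x
  partnerPoint-involutive x (row≢m , _) =
    cong (_, proj₂ (pos x)) (partnerRow-involutive row≢m (row≤n x))

  partner-paired : ∀ {x} → Paired x → Paired (partnerVertex x)
  partner-paired {x} Px = subst PairedPoint (sym (pos-partnerVertex x Px))
    ( PartnerRows⇒≢m (paired⇒partnerRows x Px)
    , subst OnBoard (sym (partnerPoint-involutive x Px)) (pos-onBoard x))

  partner-involutive : ∀ {x} → Paired x → partnerVertex (partnerVertex x) ≡ x
  partner-involutive {x} Px = pos-injective (begin
    pos (partnerVertex (partnerVertex x))
      ≡⟨ pos-partnerVertex (partnerVertex x) (partner-paired {x} Px) ⟩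
    partnerPoint (pos (partnerVertex x))
      ≡⟨ cong partnerPoint (pos-partnerVertex x Px) ⟩
    partnerPoint (partnerPoint (pos x))
      ≡⟨ partnerPoint-involutive x Px ⟩
    pos x ∎)
    where open ≡-Reasoning

  partner-adj : ∀ {u w} → Paired u → Paired w →
                GAdj n u w → GAdj n (partnerVertex u) (partnerVertex w)
  partner-adj {u} {w} Pu Pw adj = GridAdj⇒adj _ _
    (subst₂ GridAdj (sym (pos-partnerVertex u Pu)) (sym (pos-partnerVertex w Pw))
      (PartnerRows-GridAdj (paired⇒partnerRows u Pu) (paired⇒partnerRows w Pw) (adj⇒GridAdj adj)))

  partner-≢ : ∀ {x} → Paired x → partnerVertex x ≢ x
  partner-≢ {x} Px e = RowsApart⇒≢ (PartnerRows⇒apart (paired⇒partnerRows x Px))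
    (sym (trans (sym (cong proj₁ (pos-partnerVertex x Px))) (cong (proj₁ ∘ pos) e)))

  partner-nonadj : ∀ {x} → Paired x → ¬ GAdj n (partnerVertex x) x
  partner-nonadj {x} Px adj =
    RowsApart⇒¬GridAdj (swap (PartnerRows⇒apart (paired⇒partnerRows x Px)))
      (subst (λ p → GridAdj p (pos x)) (pos-partnerVertex x Px) (adj⇒GridAdj adj))

  pairing : Pairing
  pairing = record
    { centre             = centre
    ; Paired             = Paired
    ; partner            = partnerVertex
    ; centre-unpaired    = centre-unpaired
    ; paired-if-apart    = paired-if-apart
    ; partner-paired     = λ {x} → partner-paired {x}
    ; partner-involutive = partner-involutive
    ; partner-adj        = partner-adj
    ; partner-≢          = partner-≢
    ; partner-nonadj     = partner-nonadj
    }

  firstPlayerWin : Snort.FirstPlayerWin (G n)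
  firstPlayerWin = pairing⇒firstPlayerWin vertices ∈-vertices pairing

lemma3p7 : (n : ℕ) → 2 ∣ n → 2 ≤ n → Snort.FirstPlayerWin (G n)
lemma3p7 _ (divides zero refl) ()
lemma3p7 _ (divides (suc h) refl) _ =
  subst (Snort.FirstPlayerWin ∘ G) (sym double) (EvenBoard.firstPlayerWin h)
  where
    double : suc h * 2 ≡ suc h + suc h
    double = trans (*-comm (suc h) 2) (cong (suc h +_) (+-identityʳ (suc h)))
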